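{- Let $k\ge 2$, $\varepsilon\in(0,1]$, $c_1=1/20$, $\beta=\frac{c_1\varepsilon}{16k^2}$. Let $\mathcal{D}=(D_1,\dots,D_k)$ be an optimal $k$-clustering (minimizing disagreements) of a $\pm$-labeled complete graph on $V$, $|V|=n$, with $\gamma n^2$ disagreements, and suppose $\gamma\le\frac{c_1}{16k^3}$. Let $S\subseteq V$ be $\beta$-good with respect to $\mathcal{D}$, let $S_i=S\cap D_i$, and define $C_i=S_i\cup\{u\in V\setminus S: j_u=i\}$ for $1\le i\le k$, where $j_u$ is an index maximizing $\mathrm{pval}^{\tilde S}(u,i)$ over $i$. Let $\mathrm{Large}=\{j: |C_j|\ge \frac{n}{2k}\}$ and $T_{\mathrm{low}}=\{u\in V:\mathrm{val}^{\mathcal{D}}(u)\le 1-c_1/k^2\}$. Then for each $i\in\mathrm{Large}$, $C_i\setminus T_{\mathrm{low}}=D_i\setminus T_{\mathrm{low}}$.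
   Context: A $k$-clustering is a partition of $V$ into at most $k$ parts $(A_1,\dots,A_k)$. An edge is an agreement of a clustering if it is a $+$ edge with both endpoints in the same part or a $-$ edge with endpoints in different parts; otherwise a disagreement. For a clustering $\mathcal{A}$, $\mathrm{val}^{\mathcal{A}}(u)$ is the fraction of the $n-1$ edges incident to $u$ that are agreements of $\mathcal{A}$; $\mathcal{A}^{(u,i)}$ is obtained from $\mathcal{A}$ by moving $u$ to $A_i$, and $\mathrm{pval}^{\mathcal{A}}(u,i)$ is the fraction of edges incident to $u$ that are agreements of $\mathcal{A}^{(u,i)}$. For $S\subseteq V$ partitioned as $\tilde S=(S_1,\dots,S_k)$, $\mathrm{pval}^{\tilde S}(u,i)$ is $1/|S|$ times the number of agreements on edges connecting $u$ to vertices of $S$ when $u$ is placed in cluster $i$ together with $S_i$ and each $S_l$ forms cluster $l$. $S$ is $\beta$-good with respect to $\mathcal{D}$ if its elements are distinct and $|\mathrm{pval}^{\tilde S}(u,i)-\mathrm{pval}^{\mathcal{D}}(u,i)|\le\beta$ for all $u\in V$, $i$, with $S_i=S\cap D_i$.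
   Formalization: The parameter ε ranges over the rationals in $(0,1]$. -}

module Defs where

open import Data.Nat as ℕ using (ℕ; zero; suc; _<ᵇ_)
open import Data.Fin using (Fin; toℕ) renaming (zero to fz; suc to fs)
open import Data.Fin.Properties using (_≟_)
open import Data.Bool using (Bool; true; false; if_then_else_; _∧_; not)
open import Data.Integer using (+_)
open import Data.Rational using (ℚ; _/_; 0ℚ; 1ℚ; _*_; _-_; ∣_∣; _≤_)
open import Relation.Nullary.Decidable using (⌊_⌋)
open import Function using (_∘_)
open import Relation.Binary.PropositionalEquality using (_≡_)

sumF : ∀ {n} → (Fin n → ℕ) → ℕ
sumF {zero} f = 0
sumF {suc n} f = f fz ℕ.+ sumF (f ∘ fs)

countF : ∀ {n} → (Fin n → Bool) → ℕ
countF p = sumF (λ x → if p x then 1 else 0)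

-- a / d as a rational, with the convention a / 0 = 0 (only used when the
-- paper's quantities are ill-defined anyway)
frac : ℕ → ℕ → ℚ
frac a zero = 0ℚ
frac a (suc d) = (+ a) / suc d

-- ±-labelled complete graph on V = Fin n: true = '+', false = '-'
Labeling : ℕ → Set
Labeling n = Fin n → Fin n → Bool

Symmetric : ∀ {n} → Labeling n → Set
Symmetric {n} σ = (u v : Fin n) → σ u v ≡ σ v u

-- a k-clustering: each vertex gets the index of its part (parts may be empty)
Clustering : ℕ → ℕ → Set
Clustering n k = Fin n → Fin k

agreeIdx : ∀ {n k} → Labeling n → Fin n → Fin n → Fin k → Fin k → Bool
agreeIdx σ u v a b = if σ u v then ⌊ a ≟ b ⌋ else not ⌊ a ≟ b ⌋

disagreements : ∀ {n k} → Labeling n → Clustering n k → ℕ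
disagreements {n} σ C =
  sumF (λ u → countF (λ v → (toℕ u <ᵇ toℕ v) ∧ not (agreeIdx σ u v (C u) (C v))))

Optimal : ∀ {n k} → Labeling n → Clustering n k → Set
Optimal {n} {k} σ C = (C' : Clustering n k) → disagreements σ C ℕ.≤ disagreements σ C'

val : ∀ {n k} → Labeling n → Clustering n k → Fin n → ℚ
val {n} σ C u =
  frac (countF (λ v → not ⌊ u ≟ v ⌋ ∧ agreeIdx σ u v (C u) (C v))) (n ℕ.∸ 1)

move : ∀ {n k} → Clustering n k → Fin n → Fin k → Clustering n k
move C u i w = if ⌊ w ≟ u ⌋ then i else C w

pval : ∀ {n k} → Labeling n → Clustering n k → Fin n → Fin k → ℚ
pval σ C u i = val σ (move C u i) u

Subset : ℕ → Set
Subset n = Fin n → Bool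

-- pval^{S~}(u,i) with S~ = (S ∩ D_1, ..., S ∩ D_k)
pvalS : ∀ {n k} → Labeling n → Clustering n k → Subset n → Fin n → Fin k → ℚ
pvalS σ D S u i =
  frac (countF (λ v → S v ∧ not ⌊ u ≟ v ⌋ ∧ agreeIdx σ u v i (D v))) (countF S)

Good : ∀ {n k} → Labeling n → Clustering n k → Subset n → ℚ → Set
Good {n} {k} σ D S β =
  (u : Fin n) (i : Fin k) → ∣ pvalS σ D S u i - pval σ D u i ∣ ≤ β

c₁ : ℚ
c₁ = (+ 1) / 20

inC : ∀ {n k} → Clustering n k → Subset n → (Fin n → Fin k) → Fin k → Fin n → Bool
inC D S j i u = if S u then ⌊ D u ≟ i ⌋ else ⌊ j u ≟ i ⌋

-- Call a vertex high if val^D(v) > 1 − 1/Z, where Z = k²/c₁, and let W = 16Z, so that β ≤ 1/W.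
-- For a high vertex v ∉ S with j_v ≠ D(v), goodness turns the maximality of j_v for pval^S̃
-- into val^D(v) ≤ pval^D(v, j_v) + 2/W.  Every other vertex w adds at most 2 to the agreements
-- of v in the parts D(v) and j_v plus the indicators of w ∈ D_{D(v)} and w ∈ D_{j_v}, so both
-- parts have fewer than 34n/W + 1 vertices.
-- If the claim failed at u, then u is such a vertex and i ∈ {D(u), j_u}, so D_i is small, and by
-- the same fact every vertex of C_i is either not high (at most 2Zγn of them) or lies in a small
-- part of D (at most k(34n/W + 1) of them).  As each vertex of S is missing from its own sample
-- neighbourhood, goodness also forces n ≥ W/6, and the two counts give |C_i| < n/(2k).

module Submission where

open import Defs
open import Data.Nat using (ℕ; suc; _≤_; _*_; _^_)
open import Data.Fin using (Fin)
open import Data.Bool using (Bool; true; false)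
open import Relation.Binary.PropositionalEquality using (_≡_)
open import Relation.Nullary using (¬_)
open import Function.Bundles using (_⇔_)

module Counting where

  open import Data.Nat using (zero; _+_; _<_; _<ᵇ_; z≤n)
  import Data.Nat.Properties as ℕP
  open import Data.Fin using (toℕ) renaming (zero to fz; suc to fs)
  open import Data.Fin.Properties using (_≟_; suc-injective; toℕ-injective)
  open import Data.Bool using (if_then_else_; _∧_; not)
  open import Data.Empty using (⊥-elim)
  open import Data.Sum using (_⊎_; inj₁; inj₂)
  open import Function using (_∘_)
  open import Relation.Nullary using (yes; no)
  open import Relation.Nullary.Decidable using (⌊_⌋)
  open import Relation.Unary using (Pred; Decidable)
  open import Relation.Binary.Definitions using (tri<; tri≈; tri>)
  open import Relation.Binary.PropositionalEquality
  open import Data.Nat.Solver using (module +-*-Solver)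

  indicator : Bool → ℕ
  indicator b = if b then 1 else 0

  sumF-cong : ∀ {n} {f g : Fin n → ℕ} → (∀ x → f x ≡ g x) → sumF f ≡ sumF g
  sumF-cong {zero} h = refl
  sumF-cong {suc n} h = cong₂ _+_ (h fz) (sumF-cong (h ∘ fs))

  sumF-mono-≤ : ∀ {n} {f g : Fin n → ℕ} → (∀ x → f x ≤ g x) → sumF f ≤ sumF g
  sumF-mono-≤ {zero} h = ℕP.≤-refl
  sumF-mono-≤ {suc n} h = ℕP.+-mono-≤ (h fz) (sumF-mono-≤ (h ∘ fs))

  sumF-+ : ∀ {n} (f g : Fin n → ℕ) → sumF (λ x → f x + g x) ≡ sumF f + sumF g
  sumF-+ {zero} f g = refl
  sumF-+ {suc n} f g = trans (cong (f fz + g fz +_) (sumF-+ (f ∘ fs) (g ∘ fs)))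
    (solve 4 (λ a b c d → a :+ b :+ (c :+ d) := a :+ c :+ (b :+ d)) refl (f fz) (g fz) (sumF (f ∘ fs)) (sumF (g ∘ fs)))
    where open +-*-Solver

  sumF-*ʳ : ∀ {n} (f : Fin n → ℕ) c → sumF (λ x → f x * c) ≡ sumF f * c
  sumF-*ʳ {zero} f c = refl
  sumF-*ʳ {suc n} f c = trans (cong (f fz * c +_) (sumF-*ʳ (f ∘ fs) c)) (sym (ℕP.*-distribʳ-+ c (f fz) _))

  sumF-*ˡ : ∀ {n} (f : Fin n → ℕ) c → sumF (λ x → c * f x) ≡ c * sumF f
  sumF-*ˡ f c = trans (sumF-cong (λ x → ℕP.*-comm c (f x))) (trans (sumF-*ʳ f c) (ℕP.*-comm _ c))

  sumF-const : ∀ {n} c → sumF {n} (λ _ → c) ≡ n * c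
  sumF-const {zero} c = refl
  sumF-const {suc n} c = cong (c +_) (sumF-const {n} c)

  sumF-swap : ∀ {m n} (f : Fin m → Fin n → ℕ) →
    sumF (λ x → sumF (λ y → f x y)) ≡ sumF (λ y → sumF (λ x → f x y))
  sumF-swap {zero} {n} f = sym (trans (sumF-const {n} 0) (ℕP.*-zeroʳ n))
  sumF-swap {suc m} f = trans (cong (sumF (f fz) +_) (sumF-swap (f ∘ fs))) (sym (sumF-+ (f fz) (λ y → sumF (λ x → f (fs x) y))))

  ≟-refl : ∀ {n} (x : Fin n) → ⌊ x ≟ x ⌋ ≡ true
  ≟-refl x with x ≟ x
  ... | yes _ = refl
  ... | no x≢x = ⊥-elim (x≢x refl)

  ≟-sym : ∀ {n} (x y : Fin n) → ⌊ x ≟ y ⌋ ≡ ⌊ y ≟ x ⌋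
  ≟-sym x y with x ≟ y | y ≟ x
  ... | yes _ | yes _ = refl
  ... | no _ | no _ = refl
  ... | yes x≡y | no y≢x = ⊥-elim (y≢x (sym x≡y))
  ... | no x≢y | yes y≡x = ⊥-elim (x≢y (sym y≡x))

  ≟-suc : ∀ {n} (x y : Fin n) → ⌊ fs x ≟ fs y ⌋ ≡ ⌊ x ≟ y ⌋
  ≟-suc x y with x ≟ y | fs x ≟ fs y
  ... | yes _ | yes _ = refl
  ... | no _ | no _ = refl
  ... | yes x≡y | no sx≢sy = ⊥-elim (sx≢sy (cong fs x≡y))
  ... | no x≢y | yes sx≡sy = ⊥-elim (x≢y (suc-injective sx≡sy))

  sumF-delta : ∀ {k} (c : Fin k) (g : Fin k → ℕ) → sumF (λ b → if ⌊ c ≟ b ⌋ then g b else 0) ≡ g c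
  sumF-delta {suc k} fz g rewrite ≟-refl {suc k} fz =
    trans (cong (g fz +_) (trans (sumF-const {k} 0) (ℕP.*-zeroʳ k))) (ℕP.+-identityʳ (g fz))
  sumF-delta {suc k} (fs c) g =
    trans (sumF-cong (λ b → cong (λ t → if t then g (fs b) else 0) (≟-suc c b))) (sumF-delta c (g ∘ fs))

  sumF-fibres : ∀ {n k} (D : Fin n → Fin k) (g : Fin k → ℕ) →
    sumF (λ v → g (D v)) ≡ sumF (λ b → g b * countF (λ v → ⌊ D v ≟ b ⌋))
  sumF-fibres D g = begin
    sumF (λ v → g (D v))
      ≡⟨ sumF-cong (λ v → sym (sumF-delta (D v) g)) ⟩
    sumF (λ v → sumF (λ b → if ⌊ D v ≟ b ⌋ then g b else 0))
      ≡⟨ sumF-swap (λ v b → if ⌊ D v ≟ b ⌋ then g b else 0) ⟩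
    sumF (λ b → sumF (λ v → if ⌊ D v ≟ b ⌋ then g b else 0))
      ≡⟨ sumF-cong (λ b → trans (sumF-cong (λ v → select (⌊ D v ≟ b ⌋) (g b))) (sumF-*ˡ (λ v → indicator ⌊ D v ≟ b ⌋) (g b))) ⟩
    sumF (λ b → g b * countF (λ v → ⌊ D v ≟ b ⌋)) ∎
    where
    open ≡-Reasoning
    select : ∀ c y → (if c then y else 0) ≡ y * indicator c
    select true y = sym (ℕP.*-identityʳ y)
    select false y = sym (ℕP.*-zeroʳ y)

  countF-≤ : ∀ {n} (p : Fin n → Bool) → countF p ≤ n
  countF-≤ {n} p = subst (countF p ≤_) (trans (sumF-const {n} 1) (ℕP.*-identityʳ n)) (sumF-mono-≤ atMostOne)
    where
    atMostOne : ∀ x → indicator (p x) ≤ 1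
    atMostOne x with p x
    ... | true = ℕP.≤-refl
    ... | false = z≤n

  countF-mono : ∀ {n} {p q : Fin n → Bool} → (∀ x → p x ≡ true → q x ≡ true) → countF p ≤ countF q
  countF-mono {p = p} {q} p⊆q = sumF-mono-≤ pointwise
    where
    pointwise : ∀ x → indicator (p x) ≤ indicator (q x)
    pointwise x with p x | p⊆q x
    ... | false | _ = z≤n
    ... | true | qx rewrite qx refl = ℕP.≤-refl

  countF-split : ∀ {n} (q r : Fin n → Bool) →
    countF (λ v → q v ∧ r v) + countF (λ v → q v ∧ not (r v)) ≡ countF q
  countF-split q r = trans (sym (sumF-+ (λ v → indicator (q v ∧ r v)) (λ v → indicator (q v ∧ not (r v))))) (sumF-cong pointwise)
    where
    pointwise : ∀ x → indicator (q x ∧ r x) + indicator (q x ∧ not (r x)) ≡ indicator (q x)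
    pointwise x with q x | r x
    ... | false | _ = refl
    ... | true | true = refl
    ... | true | false = refl

  countF-remove : ∀ {n} (x : Fin n) (p : Fin n → Bool) →
    countF (λ v → not ⌊ x ≟ v ⌋ ∧ p v) + indicator (p x) ≡ countF p
  countF-remove {suc n} fz p = ℕP.+-comm (countF (p ∘ fs)) (indicator (p fz))
  countF-remove {suc n} (fs x) p = trans (ℕP.+-assoc (indicator (p fz)) _ _)
    (cong (indicator (p fz) +_) (trans
      (cong (_+ indicator (p (fs x))) (sumF-cong (λ v → cong (λ t → indicator (not t ∧ p (fs v))) (≟-suc x v))))
      (countF-remove x (p ∘ fs))))

  countF-⊆-∪ : ∀ {n p q} {P : Pred (Fin n) p} {Q : Pred (Fin n) q} (P? : Decidable P) (Q? : Decidable Q)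
    (r : Fin n → Bool) → (∀ x → r x ≡ true → P x ⊎ Q x) →
    countF r ≤ countF (λ x → ⌊ P? x ⌋) + countF (λ x → ⌊ Q? x ⌋)
  countF-⊆-∪ P? Q? r r⊆P∪Q = subst (countF r ≤_) (sumF-+ (λ x → indicator ⌊ P? x ⌋) (λ x → indicator ⌊ Q? x ⌋)) (sumF-mono-≤ pointwise)
    where
    pointwise : ∀ x → indicator (r x) ≤ indicator ⌊ P? x ⌋ + indicator ⌊ Q? x ⌋
    pointwise x with r x | r⊆P∪Q x | P? x | Q? x
    ... | false | _ | _ | _ = z≤n
    ... | true | _ | yes _ | _ = ℕP.m≤m+n 1 _
    ... | true | _ | no _ | yes _ = ℕP.≤-refl
    ... | true | r⇒ | no ¬Px | no ¬Qx with r⇒ refl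
    ...   | inj₁ Px = ⊥-elim (¬Px Px)
    ...   | inj₂ Qx = ⊥-elim (¬Qx Qx)

  countF-markov : ∀ {n p} {P : Pred (Fin n) p} (P? : Decidable P) (m : ℕ) (f : Fin n → ℕ) →
    (∀ x → P x → m ≤ f x) → countF (λ x → ⌊ P? x ⌋) * m ≤ sumF f
  countF-markov P? m f P⇒m≤f = subst (_≤ sumF f) (sumF-*ʳ (λ x → indicator ⌊ P? x ⌋) m) (sumF-mono-≤ pointwise)
    where
    pointwise : ∀ x → indicator ⌊ P? x ⌋ * m ≤ f x
    pointwise x with P? x
    ... | yes Px = subst (_≤ f x) (sym (ℕP.+-identityʳ m)) (P⇒m≤f x Px)
    ... | no _ = z≤n

  <ᵇ-true : ∀ {m n} → m < n → (m <ᵇ n) ≡ true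
  <ᵇ-true {m} {n} m<n with m <ᵇ n | ℕP.<⇒<ᵇ m<n
  ... | true | _ = refl

  <ᵇ-false : ∀ {m n} → ¬ m < n → (m <ᵇ n) ≡ false
  <ᵇ-false {m} {n} m≮n with m <ᵇ n | ℕP.<ᵇ⇒< m n
  ... | false | _ = refl
  ... | true | m<n = ⊥-elim (m≮n (m<n _))

  indicator-≢ : ∀ {n} (x v : Fin n) (b : Bool) →
    indicator (not ⌊ x ≟ v ⌋ ∧ b) ≡ indicator ((toℕ x <ᵇ toℕ v) ∧ b) + indicator ((toℕ v <ᵇ toℕ x) ∧ b)
  indicator-≢ x v b with x ≟ v
  ... | yes refl rewrite <ᵇ-false (ℕP.<-irrefl {toℕ x} refl) = refl
  ... | no x≢v with ℕP.<-cmp (toℕ x) (toℕ v)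
  ...   | tri< x<v _ v≮x rewrite <ᵇ-true x<v | <ᵇ-false v≮x = sym (ℕP.+-identityʳ _)
  ...   | tri≈ _ x≡v _ = ⊥-elim (x≢v (toℕ-injective x≡v))
  ...   | tri> x≮v _ v<x rewrite <ᵇ-false x≮v | <ᵇ-true v<x = refl

module Fractions where

  open import Data.Nat using (z<s; _+_; _<_)
  import Data.Nat.Properties as ℕP
  open import Data.Integer as ℤ using (+_; _⊖_)
  import Data.Integer.Properties as ℤP
  open import Data.Rational as ℚ using (1ℚ; toℚᵘ) renaming (_≤_ to _≤ℚ_; _<_ to _<ℚ_)
  import Data.Rational.Properties as ℚP
  open import Data.Rational.Unnormalised as ℚᵘ using (mkℚᵘ; *≡*; _≃_)
  import Data.Rational.Unnormalised.Properties as ℚᵘP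
  open import Data.Product using (_×_; _,_; proj₂)
  open import Data.Sum using (inj₁; inj₂)
  open import Relation.Binary.PropositionalEquality
  open import Function using (_∘_)
  open import Data.Integer.Solver using (module +-*-Solver)

  toℚᵘ-frac : ∀ a b → toℚᵘ (frac a (suc b)) ≃ mkℚᵘ (+ a) b
  toℚᵘ-frac a b = ℚP.toℚᵘ-fromℚᵘ (mkℚᵘ (+ a) b)

  pos-* : ∀ a b → + a ℤ.* + b ≡ + (a * b)
  pos-* a b = sym (ℤP.pos-* a b)

  frac-cancel-≤ : ∀ {a b c d} → frac a (suc b) ≤ℚ frac c (suc d) → a * suc d ≤ c * suc b
  frac-cancel-≤ {a} {b} {c} {d} a/b≤c/d = ℤP.drop‿+≤+ (subst₂ ℤ._≤_ (pos-* a (suc d)) (pos-* c (suc b))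
    (ℚᵘP.drop-*≤* (ℚᵘP.≤-respˡ-≃ (toℚᵘ-frac a b) (ℚᵘP.≤-respʳ-≃ (toℚᵘ-frac c d) (ℚP.toℚᵘ-mono-≤ a/b≤c/d)))))

  frac-cancel-< : ∀ {a b c d} → frac a (suc b) <ℚ frac c (suc d) → a * suc d < c * suc b
  frac-cancel-< {a} {b} {c} {d} a/b<c/d = ℤP.drop‿+<+ (subst₂ ℤ._<_ (pos-* a (suc d)) (pos-* c (suc b))
    (ℚᵘP.drop-*<* (ℚᵘP.<-respˡ-≃ (toℚᵘ-frac a b) (ℚᵘP.<-respʳ-≃ (toℚᵘ-frac c d) (ℚP.toℚᵘ-mono-< a/b<c/d)))))

  c₁*frac≡frac : ∀ m → c₁ ℚ.* frac 1 (suc m) ≡ frac 1 (20 * suc m)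
  c₁*frac≡frac m = ℚP.toℚᵘ-injective (ℚᵘP.≃-trans (ℚP.toℚᵘ-homo-* c₁ (frac 1 (suc m)))
    (ℚᵘP.≃-trans (ℚᵘP.*-cong (toℚᵘ-frac 1 19) (toℚᵘ-frac 1 m)) (ℚᵘP.≃-sym (toℚᵘ-frac 1 (m + 19 * suc m)))))

  1-frac≡frac : ∀ m → 1ℚ ℚ.- frac 1 (suc m) ≡ frac m (suc m)
  1-frac≡frac m = ℚP.toℚᵘ-injective (begin
    toℚᵘ (1ℚ ℚ.- frac 1 (suc m))               ≈⟨ ℚP.toℚᵘ-homo-+ 1ℚ (ℚ.- frac 1 (suc m)) ⟩
    toℚᵘ 1ℚ ℚᵘ.+ toℚᵘ (ℚ.- frac 1 (suc m))     ≈⟨ ℚᵘP.+-congʳ (toℚᵘ 1ℚ) (ℚP.toℚᵘ-homo‿- (frac 1 (suc m))) ⟩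
    toℚᵘ 1ℚ ℚᵘ.- toℚᵘ (frac 1 (suc m))         ≈⟨ ℚᵘP.+-congʳ (toℚᵘ 1ℚ) (ℚᵘP.-‿cong (toℚᵘ-frac 1 m)) ⟩
    mkℚᵘ (+ 1) 0 ℚᵘ.- mkℚᵘ (+ 1) m            ≈⟨ *≡* (solve 1 (λ M → (con (+ 1) :* (con (+ 1) :+ M) :+ con (ℤ.- + 1) :* con (+ 1)) :* (con (+ 1) :+ M) := M :* (con (+ 1) :* (con (+ 1) :+ M))) refl (+ m)) ⟩
    mkℚᵘ (+ m) m                               ≈⟨ toℚᵘ-frac m m ⟨
    toℚᵘ (frac m (suc m))                      ∎)
    where
    open ℚᵘP.≃-Reasoning
    open +-*-Solver

  -- a/b and c/d differ by at most 1/w, with the denominators cleared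
  Near : (w a b c d : ℕ) → Set
  Near w a b c d = a * d * w ≤ c * b * w + b * d × c * b * w ≤ a * d * w + b * d

  m≤n+∣m⊖n∣ : ∀ m n → m ≤ n + ℤ.∣ m ⊖ n ∣
  m≤n+∣m⊖n∣ m n with ℕP.≤-total m n
  ... | inj₁ m≤n = ℕP.≤-trans m≤n (ℕP.m≤m+n n _)
  ... | inj₂ n≤m rewrite ℤP.∣m⊖n∣≡∣n⊖m∣ m n | ℤP.∣⊖∣-≤ n≤m = ℕP.≤-reflexive (sym (ℕP.m+[n∸m]≡n n≤m))

  ∣frac-frac∣≤frac⇒Near : ∀ {a b c d f} → 0 < b → ℚ.∣ frac a b ℚ.- frac c (suc d) ∣ ≤ℚ frac 1 (suc f) →
    Near (suc f) a b c (suc d)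
  ∣frac-frac∣≤frac⇒Near {a} {suc b} {c} {d} {f} _ close =
    bound (a * suc d) (c * suc b) (m≤n+∣m⊖n∣ (a * suc d) (c * suc b)) ,
    bound (c * suc b) (a * suc d) (subst (λ e → c * suc b ≤ a * suc d + e) (ℤP.∣m⊖n∣≡∣n⊖m∣ (c * suc b) (a * suc d))
                                    (m≤n+∣m⊖n∣ (c * suc b) (a * suc d)))
    where
    δ = ℤ.∣ (a * suc d) ⊖ (c * suc b) ∣
    numerator : + a ℤ.* + suc d ℤ.+ ℤ.- + c ℤ.* + suc b ≡ (a * suc d) ⊖ (c * suc b)
    numerator = trans (cong₂ ℤ._+_ (pos-* a (suc d)) (trans (sym (ℤP.neg-distribˡ-* (+ c) (+ suc b))) (cong ℤ.-_ (pos-* c (suc b)))))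
                      (ℤP.m-n≡m⊖n (a * suc d) (c * suc b))
    toℚᵘ-∣-∣ : toℚᵘ ℚ.∣ frac a (suc b) ℚ.- frac c (suc d) ∣ ≃ ℚᵘ.∣ mkℚᵘ (+ a) b ℚᵘ.- mkℚᵘ (+ c) d ∣
    toℚᵘ-∣-∣ = ℚᵘP.≃-trans (ℚP.toℚᵘ-homo-∣-∣ (x ℚ.- y)) (ℚᵘP.∣-∣-cong (ℚᵘP.≃-trans (ℚP.toℚᵘ-homo-+ x (ℚ.- y))
      (ℚᵘP.+-cong (toℚᵘ-frac a b) (ℚᵘP.≃-trans (ℚP.toℚᵘ-homo‿- y) (ℚᵘP.-‿cong (toℚᵘ-frac c d))))))
      where x = frac a (suc b)
            y = frac c (suc d)
    δ≤ : δ * suc f ≤ suc b * suc d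
    δ≤ = ℤP.drop‿+≤+ (subst₂ ℤ._≤_ (trans (cong (λ z → + ℤ.∣ z ∣ ℤ.* + suc f) numerator) (pos-* δ (suc f))) (ℤP.*-identityˡ _)
           (ℚᵘP.drop-*≤* (ℚᵘP.≤-respˡ-≃ toℚᵘ-∣-∣ (ℚᵘP.≤-respʳ-≃ (toℚᵘ-frac 1 f) (ℚP.toℚᵘ-mono-≤ close)))))
    bound : ∀ x y → x ≤ y + δ → x * suc f ≤ y * suc f + suc b * suc d
    bound x y x≤y+δ = ℕP.≤-trans (ℕP.*-monoˡ-≤ (suc f) x≤y+δ)
      (ℕP.≤-trans (ℕP.≤-reflexive (ℕP.*-distribʳ-+ (suc f) y δ)) (ℕP.+-monoʳ-≤ (y * suc f) δ≤))

  ∣0-frac∣≤frac⇒ : ∀ {a c d f} → ℚ.∣ frac a 0 ℚ.- frac c (suc d) ∣ ≤ℚ frac 1 (suc f) → c * suc f ≤ suc d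
  ∣0-frac∣≤frac⇒ {a} {c} {d} {f} close = subst₂ _≤_ (cong (_* suc f) (ℕP.*-identityʳ c)) (ℕP.+-identityʳ (suc d))
    (proj₂ (∣frac-frac∣≤frac⇒Near {0} {1} {c} {d} {f} z<s close))

  frac-≤-numerator : ∀ {a b c} → 0 < b → frac a b ≤ℚ frac c b → a ≤ c
  frac-≤-numerator {a} {suc b} {c} _ a/b≤c/b = ℕP.*-cancelʳ-≤ a c (suc b) (frac-cancel-≤ {a} {b} {c} {b} a/b≤c/b)

  frac>1-frac⇒ : ∀ {l N z} → ¬ (frac l (suc N) ≤ℚ 1ℚ ℚ.- frac 1 (suc z)) → z * suc N < l * suc z
  frac>1-frac⇒ {l} {N} {z} l/N≰1-1/z = frac-cancel-< {z} {z} {l} {N} (subst (_<ℚ frac l (suc N)) (1-frac≡frac z) (ℚP.≰⇒> l/N≰1-1/z))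

  frac>1-c₁*frac⇒ : ∀ {l N m} → ¬ (frac l (suc N) ≤ℚ 1ℚ ℚ.- c₁ ℚ.* frac 1 (suc m)) →
    (m + 19 * suc m) * suc N < l * (20 * suc m)
  frac>1-c₁*frac⇒ {l} {N} {m} = frac>1-frac⇒ {l} {N} {m + 19 * suc m} ∘ subst (λ q → ¬ (frac l (suc N) ≤ℚ 1ℚ ℚ.- q)) (c₁*frac≡frac m)

  frac≤c₁*frac⇒ : ∀ {a b m} → frac a (suc b) ≤ℚ c₁ ℚ.* frac 1 (suc m) → a * (20 * suc m) ≤ suc b
  frac≤c₁*frac⇒ {a} {b} {m} a/b≤c₁/m = subst (a * (20 * suc m) ≤_) (ℕP.*-identityˡ (suc b))
    (frac-cancel-≤ {a} {b} {1} {m + 19 * suc m} (subst (frac a (suc b) ≤ℚ_) (c₁*frac≡frac m) a/b≤c₁/m))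

  c₁*ε*frac≤frac : ∀ {ε} m → ε ≤ℚ 1ℚ → c₁ ℚ.* ε ℚ.* frac 1 (suc m) ≤ℚ frac 1 (20 * suc m)
  c₁*ε*frac≤frac {ε} m ε≤1 = ℚP.≤-trans (ℚP.*-monoʳ-≤-nonNeg (frac 1 (suc m)) (ℚP.*-monoˡ-≤-nonNeg c₁ ε≤1))
    (ℚP.≤-reflexive (trans (cong (ℚ._* frac 1 (suc m)) (ℚP.*-identityʳ c₁)) (c₁*frac≡frac m)))
    where
    instance
      c₁≥0 : ℚ.NonNegative c₁
      c₁≥0 = ℚP.normalize-nonNeg 1 20
      frac≥0 : ℚ.NonNegative (frac 1 (suc m))
      frac≥0 = ℚP.normalize-nonNeg 1 (suc m)

module LocalCounts {n k} (σ : Labeling n) (D : Clustering n k) (S : Subset n) where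

  open import Data.Nat using (z<s; _+_; _<_; _∸_; _<ᵇ_; z≤n)
  import Data.Nat.Properties as ℕP
  open import Data.Fin using (toℕ)
  open import Data.Fin.Properties using (_≟_)
  open import Data.Bool using (if_then_else_; _∧_; not)
  import Data.Bool.Properties as BoolP
  open import Data.Empty using (⊥-elim)
  open import Relation.Nullary using (yes; no)
  open import Relation.Nullary.Decidable using (⌊_⌋)
  open import Relation.Binary.PropositionalEquality
  open Counting

  agree : Fin n → Fin k → ℕ
  agree x a = countF (λ v → not ⌊ x ≟ v ⌋ ∧ agreeIdx σ x v a (D v))

  agreeS : Fin n → Fin k → ℕ
  agreeS x a = countF (λ v → S v ∧ not ⌊ x ≟ v ⌋ ∧ agreeIdx σ x v a (D v))

  disagree : Fin n → ℕ
  disagree x = countF (λ v → not ⌊ x ≟ v ⌋ ∧ not (agreeIdx σ x v (D x) (D v)))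

  sizeWithout : Fin n → Fin k → ℕ
  sizeWithout x b = countF (λ v → not ⌊ x ≟ v ⌋ ∧ ⌊ D v ≟ b ⌋)

  size : Fin k → ℕ
  size b = countF (λ v → ⌊ D v ≟ b ⌋)

  pval≡agree : ∀ x a → pval σ D x a ≡ frac (agree x a) (n ∸ 1)
  pval≡agree x a = cong (λ m → frac m (n ∸ 1)) (sumF-cong (λ v → cong indicator (moved v)))
    where
    moved : ∀ v → (not ⌊ x ≟ v ⌋ ∧ agreeIdx σ x v (move D x a x) (move D x a v))
                ≡ (not ⌊ x ≟ v ⌋ ∧ agreeIdx σ x v a (D v))
    moved v rewrite ≟-refl x | ≟-sym v x with x ≟ v
    ... | yes _ = refl
    ... | no _ = refl

  others+1≡n : ∀ (x : Fin n) → countF (λ v → not ⌊ x ≟ v ⌋) + 1 ≡ n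
  others+1≡n x = begin
    countF (λ v → not ⌊ x ≟ v ⌋) + 1
      ≡⟨ cong (_+ 1) (sumF-cong (λ v → cong indicator (sym (BoolP.∧-identityʳ (not ⌊ x ≟ v ⌋))))) ⟩
    countF (λ v → not ⌊ x ≟ v ⌋ ∧ true) + 1
      ≡⟨ countF-remove x (λ (_ : Fin n) → true) ⟩
    countF {n} (λ _ → true)
      ≡⟨ trans (sumF-const {n} 1) (ℕP.*-identityʳ n) ⟩
    n ∎
    where open ≡-Reasoning

  others≡n∸1 : ∀ (x : Fin n) → countF (λ v → not ⌊ x ≟ v ⌋) ≡ n ∸ 1
  others≡n∸1 x = trans (sym (ℕP.m+n∸n≡m _ 1)) (cong (_∸ 1) (others+1≡n x))

  agree+disagree≡n∸1 : ∀ x → agree x (D x) + disagree x ≡ n ∸ 1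
  agree+disagree≡n∸1 x = trans (countF-split (λ v → not ⌊ x ≟ v ⌋) (λ v → agreeIdx σ x v (D x) (D v))) (others≡n∸1 x)

  agreeS<∣S∣ : ∀ x a → S x ≡ true → agreeS x a < countF S
  agreeS<∣S∣ x a Sx = begin-strict
    agreeS x a                                                    ≤⟨ countF-mono ⊆ ⟩
    countF (λ v → not ⌊ x ≟ v ⌋ ∧ S v)                             <⟨ ℕP.m<m+n _ (subst (λ t → 0 < indicator t) (sym Sx) z<s) ⟩
    countF (λ v → not ⌊ x ≟ v ⌋ ∧ S v) + indicator (S x)           ≡⟨ countF-remove x S ⟩
    countF S                                                      ∎
    where
    ⊆ : ∀ v → (S v ∧ not ⌊ x ≟ v ⌋ ∧ agreeIdx σ x v a (D v)) ≡ true → (not ⌊ x ≟ v ⌋ ∧ S v) ≡ true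
    ⊆ v h with S v | x ≟ v
    ... | true | no _ = refl
    ... | true | yes _ = h
    ⊆ v () | false | _
    open ℕP.≤-Reasoning

  sizeWithout-own : ∀ x → sizeWithout x (D x) + 1 ≡ size (D x)
  sizeWithout-own x = subst (λ t → sizeWithout x (D x) + indicator t ≡ size (D x)) (≟-refl (D x))
    (countF-remove x (λ v → ⌊ D v ≟ D x ⌋))

  sizeWithout-other : ∀ x b → ¬ D x ≡ b → sizeWithout x b ≡ size b
  sizeWithout-other x b Dx≢b = trans (sym (ℕP.+-identityʳ (sizeWithout x b)))
    (subst (λ t → sizeWithout x b + indicator t ≡ size b) (dec≢ (D x ≟ b))
      (countF-remove x (λ v → ⌊ D v ≟ b ⌋)))
    where
    dec≢ : ∀ d → ⌊ d ⌋ ≡ false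
    dec≢ (yes Dx≡b) = ⊥-elim (Dx≢b Dx≡b)
    dec≢ (no _) = refl

  -- For a '+' edge the agreement indicators equal the two membership indicators;
  -- for a '−' edge each agreement indicator complements one of them.
  atMostTwo : ∀ (sign : Bool) (a l c : Fin k) → ¬ a ≡ l →
    indicator (if sign then ⌊ a ≟ c ⌋ else not ⌊ a ≟ c ⌋) + indicator (if sign then ⌊ l ≟ c ⌋ else not ⌊ l ≟ c ⌋)
      + indicator ⌊ c ≟ l ⌋ + indicator ⌊ c ≟ a ⌋ ≤ 2
  atMostTwo sign a l c a≢l rewrite ≟-sym a c | ≟-sym l c with c ≟ l | c ≟ a
  ... | yes c≡l | yes c≡a = ⊥-elim (a≢l (trans (sym c≡a) c≡l))
  ... | yes _ | no _ = bound sign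
    where bound : ∀ t → indicator (if t then false else true) + indicator (if t then true else false) + 1 + 0 ≤ 2
          bound true = ℕP.≤-refl
          bound false = ℕP.≤-refl
  ... | no _ | yes _ = bound sign
    where bound : ∀ t → indicator (if t then true else false) + indicator (if t then false else true) + 0 + 1 ≤ 2
          bound true = ℕP.≤-refl
          bound false = ℕP.≤-refl
  ... | no _ | no _ = bound sign
    where bound : ∀ t → indicator (if t then false else true) + indicator (if t then false else true) + 0 + 0 ≤ 2
          bound true = z≤n
          bound false = ℕP.≤-refl

  agree-two-parts : ∀ x a → ¬ a ≡ D x →
    agree x a + agree x (D x) + sizeWithout x (D x) + sizeWithout x a ≤ 2 * (n ∸ 1)
  agree-two-parts x a a≢Dx = subst₂ _≤_ sum-lhs sum-rhs (sumF-mono-≤ pointwise)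
    where
    ≢x : Fin n → Bool
    ≢x v = not ⌊ x ≟ v ⌋
    f₁ f₂ f₃ f₄ : Fin n → ℕ
    f₁ v = indicator (≢x v ∧ agreeIdx σ x v a (D v))
    f₂ v = indicator (≢x v ∧ agreeIdx σ x v (D x) (D v))
    f₃ v = indicator (≢x v ∧ ⌊ D v ≟ D x ⌋)
    f₄ v = indicator (≢x v ∧ ⌊ D v ≟ a ⌋)
    pointwise : ∀ v → f₁ v + f₂ v + f₃ v + f₄ v ≤ 2 * indicator (≢x v)
    pointwise v with ≢x v
    ... | false = z≤n
    ... | true = atMostTwo (σ x v) a (D x) (D v) a≢Dx
    sum-lhs : sumF (λ v → f₁ v + f₂ v + f₃ v + f₄ v) ≡ agree x a + agree x (D x) + sizeWithout x (D x) + sizeWithout x a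
    sum-lhs = trans (sumF-+ (λ v → f₁ v + f₂ v + f₃ v) f₄) (cong (_+ sizeWithout x a)
                (trans (sumF-+ (λ v → f₁ v + f₂ v) f₃) (cong (_+ sizeWithout x (D x)) (sumF-+ f₁ f₂))))
    sum-rhs : sumF (λ v → 2 * indicator (≢x v)) ≡ 2 * (n ∸ 1)
    sum-rhs = trans (sumF-*ˡ (λ v → indicator (≢x v)) 2) (cong (2 *_) (others≡n∸1 x))

  sum-disagree : Symmetric σ → sumF disagree ≡ disagreements σ D + disagreements σ D
  sum-disagree σ-sym = begin
      sumF disagree
    ≡⟨ sumF-cong (λ x → trans (sumF-cong (λ v → indicator-≢ x v (bad x v))) (sumF-+ (λ v → indicator (lt x v ∧ bad x v)) (λ v → indicator (lt v x ∧ bad x v)))) ⟩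
      sumF (λ x → countF (λ v → lt x v ∧ bad x v) + countF (λ v → lt v x ∧ bad x v))
    ≡⟨ sumF-+ (λ x → countF (λ v → lt x v ∧ bad x v)) (λ x → countF (λ v → lt v x ∧ bad x v)) ⟩
      disagreements σ D + sumF (λ x → countF (λ v → lt v x ∧ bad x v))
    ≡⟨ cong (disagreements σ D +_) (trans (sumF-swap (λ x v → indicator (lt v x ∧ bad x v)))
         (sumF-cong (λ v → sumF-cong (λ x → cong (λ t → indicator (lt v x ∧ t)) (bad-sym x v))))) ⟩
      disagreements σ D + disagreements σ D ∎
    where
    open ≡-Reasoning
    lt : Fin n → Fin n → Bool
    lt x v = toℕ x <ᵇ toℕ v
    bad : Fin n → Fin n → Bool
    bad x v = not (agreeIdx σ x v (D x) (D v))
    bad-sym : ∀ x v → bad x v ≡ bad v x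
    bad-sym x v rewrite σ-sym x v | ≟-sym (D x) (D v) = refl

module Argument {N′ k : ℕ} (σ : Labeling (suc (suc N′))) (D : Clustering (suc (suc N′)) k)
                (S : Subset (suc (suc N′))) (j : Fin (suc (suc N′)) → Fin k) (2≤k : 2 ≤ k) where

  open import Data.Nat as ℕ using (_+_; _<_; z≤n; s≤s)
  open import Data.Nat.Properties hiding (_≟_)
  open import Data.Fin.Properties using (_≟_)
  open import Data.Empty using (⊥; ⊥-elim)
  open import Data.Product using (_×_; _,_; proj₁; proj₂)
  open import Data.Sum using (_⊎_; inj₁; inj₂)
  open import Relation.Nullary using (yes; no)
  open import Relation.Nullary.Decidable using (⌊_⌋)
  open import Relation.Unary using (Decidable)
  open import Relation.Binary.PropositionalEquality
  open import Data.Nat.Solver using (module +-*-Solver)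
  open +-*-Solver
  open Counting
  open Fractions
  open LocalCounts σ D S

  -- High x is val^D(x) > 1 − c₁/k² (its negation Low is membership in T_low), and W ≤ 1/β.
  n N Z W ∣S∣ : ℕ
  n = suc (suc N′)
  N = suc N′
  Z = 20 * k ^ 2
  W = 20 * (16 * k ^ 2)
  ∣S∣ = countF S

  High Low : Fin n → Set
  High x = Z * disagree x < N
  Low x = N ≤ Z * disagree x

  Low? : Decidable Low
  Low? x = N ≤? Z * disagree x

  Small : Fin k → Set
  Small b = W * size b < 34 * N + W

  Small? : Decidable Small
  Small? b = W * size b <? 34 * N + W

  instance
    k≢0 : ℕ.NonZero k
    k≢0 = ℕ.>-nonZero (≤-trans (s≤s z≤n) 2≤k)

  -- For empty S every pvalS is 0 (frac a 0 = 0), so goodness would bound val^D(u) by 1/W.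
  ∣S∣>0 : ∀ u → High u → (∣S∣ ≡ 0 → agree u (D u) * W ≤ N) → 0 < ∣S∣
  ∣S∣>0 u high far-if-empty = n≢0⇒n>0 (λ ∣S∣≡0 → <⇒≱ (16ZN<17N (far-if-empty ∣S∣≡0)) 17N≤16ZN)
    where
    open ≤-Reasoning
    L = agree u (D u)
    d = disagree u
    16ZN<17N : L * W ≤ N → 16 * Z * N < 17 * N
    16ZN<17N LW≤N = begin-strict
      16 * Z * N             ≡⟨ cong (16 * Z *_) (sym (agree+disagree≡n∸1 u)) ⟩
      16 * Z * (L + d)       ≡⟨ solve 3 (λ L d K → con 16 :* (con 20 :* K) :* (L :+ d) := L :* (con 20 :* (con 16 :* K)) :+ con 16 :* (con 20 :* K :* d)) refl L d (k ^ 2) ⟩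
      L * W + 16 * (Z * d)   <⟨ +-mono-≤-< LW≤N (*-monoʳ-< 16 high) ⟩
      N + 16 * N             ≡⟨ solve 1 (λ N → N :+ con 16 :* N := con 17 :* N) refl N ⟩
      17 * N                 ∎
    17N≤16ZN : 17 * N ≤ 16 * Z * N
    17N≤16ZN = *-monoˡ-≤ N (≤-trans (m≤m+n 17 303) (*-monoʳ-≤ 16 (*-monoʳ-≤ 20 (m^n>0 k 2))))

  module _ (σ-sym : Symmetric σ)
           (sparse : disagreements σ D * (k * W) ≤ n * n)
           (∣S∣>0 : 0 < ∣S∣)
           (near : ∀ x a → Near W (agreeS x a) ∣S∣ (agree x a) N)
           (j-max : ∀ x → S x ≡ false → ∀ a → agreeS x a ≤ agreeS x (j x)) where

    instance
      ∣S∣≢0 : ℕ.NonZero ∣S∣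
      ∣S∣≢0 = ℕ.>-nonZero ∣S∣>0

    own≤chosen : ∀ v → S v ≡ false → agree v (D v) * W ≤ agree v (j v) * W + 2 * N
    own≤chosen v Sv = *-cancelˡ-≤ ∣S∣ (begin
      ∣S∣ * (L * W)                      ≡⟨ solve 3 (λ s L W → s :* (L :* W) := L :* s :* W) refl ∣S∣ L W ⟩
      L * ∣S∣ * W                        ≤⟨ proj₂ (near v (D v)) ⟩
      agreeS v (D v) * N * W + ∣S∣ * N   ≤⟨ +-monoˡ-≤ (∣S∣ * N) (*-monoˡ-≤ W (*-monoˡ-≤ N (j-max v Sv (D v)))) ⟩
      agreeS v (j v) * N * W + ∣S∣ * N   ≤⟨ +-monoˡ-≤ (∣S∣ * N) (proj₁ (near v (j v))) ⟩
      A * ∣S∣ * W + ∣S∣ * N + ∣S∣ * N    ≡⟨ solve 4 (λ s A W N → A :* s :* W :+ s :* N :+ s :* N := s :* (A :* W :+ con 2 :* N)) refl ∣S∣ A W N ⟩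
      ∣S∣ * (A * W + 2 * N)              ∎)
      where
      open ≤-Reasoning
      L = agree v (D v)
      A = agree v (j v)

    switched-sizes : ∀ v → S v ≡ false → ¬ j v ≡ D v → High v →
      (sizeWithout v (D v) + sizeWithout v (j v)) * W < 34 * N
    switched-sizes v Sv jv≢Dv high = begin-strict
      (E₁ + E₂) * W               ≤⟨ +-cancelˡ-≤ (2 * (L * W)) _ _ twice ⟩
      2 * (d * W) + 2 * N         ≡⟨ cong (_+ 2 * N) (solve 2 (λ d K → con 2 :* (d :* (con 20 :* (con 16 :* K))) := con 32 :* (con 20 :* K :* d)) refl d (k ^ 2)) ⟩
      32 * (Z * d) + 2 * N        <⟨ +-monoˡ-< (2 * N) (*-monoʳ-< 32 high) ⟩
      32 * N + 2 * N              ≡⟨ solve 1 (λ N → con 32 :* N :+ con 2 :* N := con 34 :* N) refl N ⟩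
      34 * N                      ∎
      where
      open ≤-Reasoning
      L = agree v (D v)
      A = agree v (j v)
      d = disagree v
      E₁ = sizeWithout v (D v)
      E₂ = sizeWithout v (j v)
      twice : 2 * (L * W) + (E₁ + E₂) * W ≤ 2 * (L * W) + (2 * (d * W) + 2 * N)
      twice = begin
        2 * (L * W) + (E₁ + E₂) * W        ≡⟨ solve 4 (λ L E₁ E₂ W → con 2 :* (L :* W) :+ (E₁ :+ E₂) :* W := L :* W :+ (L :+ E₁ :+ E₂) :* W) refl L E₁ E₂ W ⟩
        L * W + (L + E₁ + E₂) * W          ≤⟨ +-monoˡ-≤ _ (own≤chosen v Sv) ⟩
        A * W + 2 * N + (L + E₁ + E₂) * W  ≡⟨ solve 6 (λ A L E₁ E₂ W N → A :* W :+ con 2 :* N :+ (L :+ E₁ :+ E₂) :* W := (A :+ L :+ E₁ :+ E₂) :* W :+ con 2 :* N) refl A L E₁ E₂ W N ⟩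
        (A + L + E₁ + E₂) * W + 2 * N      ≤⟨ +-monoˡ-≤ (2 * N) (*-monoˡ-≤ W (agree-two-parts v (j v) jv≢Dv)) ⟩
        2 * N * W + 2 * N                  ≡⟨ cong (λ m → 2 * m * W + 2 * N) (sym (agree+disagree≡n∸1 v)) ⟩
        2 * (L + d) * W + 2 * N            ≡⟨ solve 4 (λ L d W N → con 2 :* (L :+ d) :* W :+ con 2 :* N := con 2 :* (L :* W) :+ (con 2 :* (d :* W) :+ con 2 :* N)) refl L d W N ⟩
        2 * (L * W) + (2 * (d * W) + 2 * N) ∎

    switched⇒Small : ∀ v → S v ≡ false → ¬ j v ≡ D v → High v → Small (D v) × Small (j v)
    switched⇒Small v Sv jv≢Dv high = own , chosen
      where
      open ≤-Reasoning
      E₁ = sizeWithout v (D v)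
      E₂ = sizeWithout v (j v)
      bound : (E₁ + E₂) * W < 34 * N
      bound = switched-sizes v Sv jv≢Dv high
      own : Small (D v)
      own = begin-strict
        W * size (D v)     ≡⟨ cong (W *_) (sym (sizeWithout-own v)) ⟩
        W * (E₁ + 1)       ≡⟨ solve 2 (λ E₁ W → W :* (E₁ :+ con 1) := E₁ :* W :+ W) refl E₁ W ⟩
        E₁ * W + W         ≤⟨ +-monoˡ-≤ W (*-monoˡ-≤ W (m≤m+n E₁ E₂)) ⟩
        (E₁ + E₂) * W + W  <⟨ +-monoˡ-< W bound ⟩
        34 * N + W         ∎
      chosen : Small (j v)
      chosen = begin-strict
        W * size (j v)     ≡⟨ cong (W *_) (sym (sizeWithout-other v (j v) (λ Dv≡jv → jv≢Dv (sym Dv≡jv)))) ⟩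
        W * E₂             ≡⟨ *-comm W E₂ ⟩
        E₂ * W             ≤⟨ *-monoˡ-≤ W (m≤n+m E₂ E₁) ⟩
        (E₁ + E₂) * W      <⟨ bound ⟩
        34 * N             ≤⟨ m≤m+n (34 * N) W ⟩
        34 * N + W         ∎

    inC⇒Low⊎Small : ∀ i → Small i → ∀ v → inC D S j i v ≡ true → Low v ⊎ Small (D v)
    inC⇒Low⊎Small i small-i v v∈C with S v in Sv | D v ≟ i
    ... | _ | yes refl = inj₂ small-i
    ... | true | no _ = ⊥-elim (contradiction v∈C)
      where contradiction : false ≡ true → ⊥
            contradiction ()
    ... | false | no Dv≢i with j v ≟ i
    ...   | no _ = ⊥-elim (contradiction v∈C)
      where contradiction : false ≡ true → ⊥
            contradiction ()
    ...   | yes refl with ≤-<-connex N (Z * disagree v)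
    ...     | inj₁ low = inj₁ low
    ...     | inj₂ high = inj₂ (proj₁ (switched⇒Small v Sv (λ jv≡Dv → Dv≢i (sym jv≡Dv)) high))

    count-Low : countF (λ v → ⌊ Low? v ⌋) * N ≤ Z * (disagreements σ D + disagreements σ D)
    count-Low = begin
      countF (λ v → ⌊ Low? v ⌋) * N    ≤⟨ countF-markov Low? N (λ v → Z * disagree v) (λ _ low → low) ⟩
      sumF (λ v → Z * disagree v)      ≡⟨ sumF-*ˡ disagree Z ⟩
      Z * sumF disagree                ≡⟨ cong (Z *_) (sum-disagree σ-sym) ⟩
      Z * (disagreements σ D + disagreements σ D) ∎
      where open ≤-Reasoning

    count-Small : countF (λ v → ⌊ Small? (D v) ⌋) * W ≤ k * (34 * N + W)
    count-Small = begin
      countF (λ v → ⌊ Small? (D v) ⌋) * W                 ≡⟨ cong (_* W) (sumF-fibres D (λ b → indicator ⌊ Small? b ⌋)) ⟩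
      sumF (λ b → indicator ⌊ Small? b ⌋ * size b) * W    ≡⟨ sumF-*ʳ (λ b → indicator ⌊ Small? b ⌋ * size b) W ⟨
      sumF (λ b → indicator ⌊ Small? b ⌋ * size b * W)    ≤⟨ sumF-mono-≤ bounded ⟩
      sumF {k} (λ _ → 34 * N + W)                          ≡⟨ sumF-const {k} (34 * N + W) ⟩
      k * (34 * N + W)                                     ∎
      where
      open ≤-Reasoning
      bounded : ∀ b → indicator ⌊ Small? b ⌋ * size b * W ≤ 34 * N + W
      bounded b with Small? b
      ... | yes small = ≤-trans (≤-reflexive (solve 2 (λ c W → con 1 :* c :* W := W :* c) refl (size b) W)) (<⇒≤ small)
      ... | no _ = z≤n

    -- x is not among its own sample neighbours, so agreeS x (D x) < |S|, and goodness gives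
    -- disagree x / N ≥ 1/|S| − 1/W.
    disagree-lower-bound : ∀ x → S x ≡ true → N * W ≤ disagree x * ∣S∣ * W + ∣S∣ * N
    disagree-lower-bound x Sx = +-cancelˡ-≤ (L * ∣S∣ * W) _ _ (begin
      L * ∣S∣ * W + N * W                    ≤⟨ +-monoˡ-≤ (N * W) (proj₂ (near x (D x))) ⟩
      B * N * W + ∣S∣ * N + N * W            ≡⟨ solve 4 (λ B N W s → B :* N :* W :+ s :* N :+ N :* W := (con 1 :+ B) :* N :* W :+ s :* N) refl B N W ∣S∣ ⟩
      suc B * N * W + ∣S∣ * N                ≤⟨ +-monoˡ-≤ (∣S∣ * N) (*-monoˡ-≤ W (*-monoˡ-≤ N (agreeS<∣S∣ x (D x) Sx))) ⟩
      ∣S∣ * N * W + ∣S∣ * N                  ≡⟨ cong (λ m → ∣S∣ * m * W + ∣S∣ * N) (sym (agree+disagree≡n∸1 x)) ⟩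
      ∣S∣ * (L + d) * W + ∣S∣ * N            ≡⟨ solve 5 (λ s L d W N → s :* (L :+ d) :* W :+ s :* N := L :* s :* W :+ (d :* s :* W :+ s :* N)) refl ∣S∣ L d W N ⟩
      L * ∣S∣ * W + (d * ∣S∣ * W + ∣S∣ * N)  ∎)
      where
      open ≤-Reasoning
      L = agree x (D x)
      B = agreeS x (D x)
      d = disagree x

    sum-disagree-lower-bound : N * W ≤ sumF disagree * W + ∣S∣ * N
    sum-disagree-lower-bound = *-cancelˡ-≤ ∣S∣ (begin
      ∣S∣ * (N * W)                                                ≡⟨ sumF-*ʳ (λ x → indicator (S x)) (N * W) ⟨
      sumF (λ x → indicator (S x) * (N * W))                       ≤⟨ sumF-mono-≤ pointwise ⟩
      sumF (λ x → disagree x * ∣S∣ * W + indicator (S x) * (∣S∣ * N)) ≡⟨ sumF-+ (λ x → disagree x * ∣S∣ * W) (λ x → indicator (S x) * (∣S∣ * N)) ⟩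
      sumF (λ x → disagree x * ∣S∣ * W) + sumF (λ x → indicator (S x) * (∣S∣ * N))
        ≡⟨ cong₂ _+_ (trans (sumF-*ʳ (λ x → disagree x * ∣S∣) W) (cong (_* W) (sumF-*ʳ disagree ∣S∣))) (sumF-*ʳ (λ x → indicator (S x)) (∣S∣ * N)) ⟩
      sumF disagree * ∣S∣ * W + ∣S∣ * (∣S∣ * N)                     ≡⟨ solve 4 (λ Σ s W N → Σ :* s :* W :+ s :* (s :* N) := s :* (Σ :* W :+ s :* N)) refl (sumF disagree) ∣S∣ W N ⟩
      ∣S∣ * (sumF disagree * W + ∣S∣ * N)                           ∎)
      where
      open ≤-Reasoning
      pointwise : ∀ x → indicator (S x) * (N * W) ≤ disagree x * ∣S∣ * W + indicator (S x) * (∣S∣ * N)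
      pointwise x with S x in Sx
      ... | false = z≤n
      ... | true = subst₂ _≤_ (sym (*-identityˡ (N * W))) (cong (disagree x * ∣S∣ * W +_) (sym (*-identityˡ (∣S∣ * N))))
                     (disagree-lower-bound x Sx)

    n≤2N : n ≤ 2 * N
    n≤2N = subst (n ≤_) (solve 1 (λ N → N :+ N := con 2 :* N) refl N) (+-monoˡ-≤ N (s≤s z≤n))

    W≤6N : W ≤ 6 * N
    W≤6N = *-cancelˡ-≤ (k * N) {{m*n≢0 k N}} (begin
      k * N * W                                   ≡⟨ *-assoc k N W ⟩
      k * (N * W)                                 ≤⟨ *-monoʳ-≤ k sum-disagree-lower-bound ⟩
      k * (sumF disagree * W + ∣S∣ * N)           ≡⟨ cong (λ t → k * (t * W + ∣S∣ * N)) (sum-disagree σ-sym) ⟩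
      k * ((dis + dis) * W + ∣S∣ * N)             ≡⟨ solve 5 (λ k d W s N → k :* ((d :+ d) :* W :+ s :* N) := con 2 :* (d :* (k :* W)) :+ k :* s :* N) refl k dis W ∣S∣ N ⟩
      2 * (dis * (k * W)) + k * ∣S∣ * N           ≤⟨ +-mono-≤ (*-monoʳ-≤ 2 sparse) (*-monoˡ-≤ N (*-monoʳ-≤ k (≤-trans (countF-≤ S) n≤2N))) ⟩
      2 * (n * n) + k * (2 * N) * N               ≤⟨ +-monoˡ-≤ _ (*-monoʳ-≤ 2 (*-mono-≤ n≤2N n≤2N)) ⟩
      2 * (2 * N * (2 * N)) + k * (2 * N) * N     ≡⟨ solve 2 (λ k N → con 2 :* (con 2 :* N :* (con 2 :* N)) :+ k :* (con 2 :* N) :* N := con 8 :* (N :* N) :+ con 2 :* (k :* (N :* N))) refl k N ⟩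
      8 * (N * N) + 2 * (k * (N * N))             ≤⟨ +-monoˡ-≤ _ (*-monoˡ-≤ (N * N) (*-monoˡ-≤ 4 2≤k)) ⟩
      k * 4 * (N * N) + 2 * (k * (N * N))         ≡⟨ solve 2 (λ k N → k :* con 4 :* (N :* N) :+ con 2 :* (k :* (N :* N)) := k :* N :* (con 6 :* N)) refl k N ⟩
      k * N * (6 * N)                             ∎)
      where
      open ≤-Reasoning
      dis = disagreements σ D

    no-large-switched-part : ∀ u → S u ≡ false → ¬ j u ≡ D u → High u →
      ∀ i → i ≡ D u ⊎ i ≡ j u → ¬ n ≤ 2 * k * countF (inC D S j i)
    no-large-switched-part u Su ju≢Du high i i∈ large = <⇒≱ 2n²+2N²<8Nn 8Nn≤2n²+2N²
      where
      open ≤-Reasoning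
      dis = disagreements σ D
      X = countF (λ v → ⌊ Low? v ⌋)
      Y = countF (λ v → ⌊ Small? (D v) ⌋)
      small : ∀ {b} → b ≡ D u ⊎ b ≡ j u → Small b
      small (inj₁ refl) = proj₁ (switched⇒Small u Su ju≢Du high)
      small (inj₂ refl) = proj₂ (switched⇒Small u Su ju≢Du high)
      C≤X+Y : countF (inC D S j i) ≤ X + Y
      C≤X+Y = countF-⊆-∪ {Q = λ v → Small (D v)} Low? (λ v → Small? (D v)) (inC D S j i) (inC⇒Low⊎Small i (small i∈))
      8kNX≤n² : 8 * k * N * X ≤ n * n
      8kNX≤n² = begin
        8 * k * N * X                  ≡⟨ solve 3 (λ k N X → con 8 :* k :* N :* X := con 8 :* k :* (X :* N)) refl k N X ⟩
        8 * k * (X * N)                ≤⟨ *-monoʳ-≤ (8 * k) count-Low ⟩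
        8 * k * (Z * (dis + dis))      ≡⟨ solve 2 (λ k d → con 8 :* k :* (con 20 :* k :^ 2 :* (d :+ d)) := d :* (k :* (con 20 :* (con 16 :* k :^ 2)))) refl k dis ⟩
        dis * (k * W)                  ≤⟨ sparse ⟩
        n * n                          ∎
      8kY≤N : 8 * k * Y ≤ N
      8kY≤N = *-cancelˡ-≤ (40 * k) {{m*n≢0 40 k}} (begin
        40 * k * (8 * k * Y)           ≡⟨ solve 2 (λ k Y → con 40 :* k :* (con 8 :* k :* Y) := Y :* (con 20 :* (con 16 :* k :^ 2))) refl k Y ⟩
        Y * W                          ≤⟨ count-Small ⟩
        k * (34 * N + W)               ≤⟨ *-monoʳ-≤ k (+-monoʳ-≤ (34 * N) W≤6N) ⟩
        k * (34 * N + 6 * N)           ≡⟨ solve 2 (λ k N → k :* (con 34 :* N :+ con 6 :* N) := con 40 :* k :* N) refl k N ⟩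
        40 * k * N                     ∎)
      8Nn≤2n²+2N² : 8 * N * n ≤ 2 * (n * n) + 2 * (N * N)
      8Nn≤2n²+2N² = begin
        8 * N * n                              ≤⟨ *-monoʳ-≤ (8 * N) large ⟩
        8 * N * (2 * k * countF (inC D S j i)) ≤⟨ *-monoʳ-≤ (8 * N) (*-monoʳ-≤ (2 * k) C≤X+Y) ⟩
        8 * N * (2 * k * (X + Y))              ≡⟨ solve 4 (λ N k X Y → con 8 :* N :* (con 2 :* k :* (X :+ Y)) := con 2 :* (con 8 :* k :* N :* X) :+ con 2 :* N :* (con 8 :* k :* Y)) refl N k X Y ⟩
        2 * (8 * k * N * X) + 2 * N * (8 * k * Y) ≤⟨ +-mono-≤ (*-monoʳ-≤ 2 8kNX≤n²) (*-monoʳ-≤ (2 * N) 8kY≤N) ⟩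
        2 * (n * n) + 2 * N * N                ≡⟨ cong (2 * (n * n) +_) (*-assoc 2 N N) ⟩
        2 * (n * n) + 2 * (N * N)              ∎
      2n²+2N²<8Nn : 2 * (n * n) + 2 * (N * N) < 8 * N * n
      2n²+2N²<8Nn = begin-strict
        2 * (n * n) + 2 * (N * N)                               <⟨ m<m+n _ (s≤s z≤n) ⟩
        2 * (n * n) + 2 * (N * N) + (6 + 4 * (N′ * N′) + 12 * N′) ≡⟨ solve 1 (λ M → con 2 :* ((con 2 :+ M) :* (con 2 :+ M)) :+ con 2 :* ((con 1 :+ M) :* (con 1 :+ M)) :+ (con 6 :+ con 4 :* (M :* M) :+ con 12 :* M) := con 8 :* (con 1 :+ M) :* (con 2 :+ M)) refl N′ ⟩
        8 * N * n                                               ∎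

open import Data.Rational using (ℚ; 0ℚ; 1ℚ; _<_; _-_) renaming (_≤_ to _≤ℚ_; _*_ to _*ℚ_)
open Counting using (countF-≤)
open Fractions
import Data.Nat as ℕ
import Data.Nat.Properties as ℕP
import Data.Rational as ℚ
import Data.Rational.Properties as ℚP
open import Data.Fin.Properties using (_≟_)
open import Data.Empty using (⊥-elim)
open import Data.Sum using (_⊎_; inj₁; inj₂)
open import Function.Bundles using (mk⇔)
open import Relation.Nullary using (yes; no)
open import Relation.Binary.PropositionalEquality using (refl; sym; trans; cong; subst; subst₂)
open import Data.Nat.Solver using (module +-*-Solver)

inC⇔ : ∀ {n k} (D : Clustering n k) (S : Subset n) (j : Fin n → Fin k) (i : Fin k) (u : Fin n) →
  (S u ≡ false → ¬ j u ≡ D u → ¬ (i ≡ D u ⊎ i ≡ j u)) → (inC D S j i u ≡ true) ⇔ (D u ≡ i)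
inC⇔ D S j i u unswitched with S u | D u ≟ i | j u ≟ i
... | true | yes Du≡i | _ = mk⇔ (λ _ → Du≡i) (λ _ → refl)
... | true | no Du≢i | _ = mk⇔ (λ ()) (λ Du≡i → ⊥-elim (Du≢i Du≡i))
... | false | yes Du≡i | yes _ = mk⇔ (λ _ → Du≡i) (λ _ → refl)
... | false | no Du≢i | no _ = mk⇔ (λ ()) (λ Du≡i → ⊥-elim (Du≢i Du≡i))
... | false | yes Du≡i | no ju≢i =
  ⊥-elim (unswitched refl (λ ju≡Du → ju≢i (trans ju≡Du Du≡i)) (inj₁ (sym Du≡i)))
... | false | no Du≢i | yes ju≡i =
  ⊥-elim (unswitched refl (λ ju≡Du → Du≢i (trans (sym ju≡Du) ju≡i)) (inj₂ (sym ju≡i)))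

z*N<l*[1+z]⇒[1+z]*d<N : ∀ {z l d N} → l ℕ.+ d ≡ N → z * N ℕ.< l * ℕ.suc z → ℕ.suc z * d ℕ.< N
z*N<l*[1+z]⇒[1+z]*d<N {z} {l} {d} refl cross = ℕP.<-≤-trans (ℕP.+-monoʳ-< d zd<l) (ℕP.≤-reflexive (ℕP.+-comm d l))
  where
  open +-*-Solver
  zd<l : z * d ℕ.< l
  zd<l = ℕP.+-cancelˡ-< (z * l) (z * d) l
    (subst₂ ℕ._<_ (ℕP.*-distribˡ-+ z l d) (solve 2 (λ z l → l :* (con 1 :+ z) := z :* l :+ l) refl z l) cross)

lemma10 : (n k : ℕ) → 2 ≤ k → (ε : ℚ) → 0ℚ < ε → ε ≤ℚ 1ℚ →
    (σ : Labeling n) → Symmetric σ →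
    (D : Clustering n k) → Optimal σ D →
    frac (disagreements σ D) (n * n) ≤ℚ c₁ *ℚ frac 1 (16 * k ^ 3) →
    (S : Subset n) → Good σ D S (c₁ *ℚ ε *ℚ frac 1 (16 * k ^ 2)) →
    (j : Fin n → Fin k) →
    ((u : Fin n) → S u ≡ false → (i : Fin k) → pvalS σ D S u i ≤ℚ pvalS σ D S u (j u)) →
    (i : Fin k) → n ≤ 2 * k * countF (inC D S j i) →
    (u : Fin n) → ¬ (val σ D u ≤ℚ 1ℚ - c₁ *ℚ frac 1 (k ^ 2)) →
    (inC D S j i u ≡ true) ⇔ (D u ≡ i)
lemma10 0 _ _ _ _ _ _ _ _ _ _ _ _ _ _ _ _ ()
lemma10 1 k (ℕ.s≤s (ℕ.s≤s _)) _ _ _ σ _ D _ _ _ _ _ _ _ _ u val-high =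
  ⊥-elim (ℕP.n≮0 (frac>1-c₁*frac⇒ {0} {0} {ℕ.pred (k ^ 2)} val-high))
lemma10 (ℕ.suc (ℕ.suc N′)) k 2≤k@(ℕ.s≤s (ℕ.s≤s _)) ε _ ε≤1 σ σ-sym D _ few-disagreements S good j j-max i large u val-high =
  inC⇔ D S j i u (λ Su ju≢Du i∈ → no-large-switched-part σ-sym sparse sample-nonempty near j-max-counts u Su ju≢Du high i i∈ large)
  where
  open LocalCounts σ D S
  open Argument σ D S j 2≤k
  good′ : ∀ x a → ℚ.∣ frac (agreeS x a) ∣S∣ - frac (agree x a) N ∣ ≤ℚ frac 1 W
  good′ x a = ℚP.≤-trans (subst (λ q → ℚ.∣ pvalS σ D S x a - q ∣ ≤ℚ c₁ *ℚ ε *ℚ frac 1 (16 * k ^ 2)) (pval≡agree x a) (good x a))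
                         (c₁*ε*frac≤frac (ℕ.pred (16 * k ^ 2)) ε≤1)
  high : High u
  high = z*N<l*[1+z]⇒[1+z]*d<N {ℕ.pred Z} {agree u (D u)} {disagree u} (agree+disagree≡n∸1 u)
           (frac>1-c₁*frac⇒ {agree u (D u)} {N′} {ℕ.pred (k ^ 2)} val-high)
  sparse : disagreements σ D * (k * W) ≤ n * n
  sparse = subst (λ w → disagreements σ D * w ≤ n * n)
             (solve 1 (λ k → con 20 :* (con 16 :* k :^ 3) := k :* (con 20 :* (con 16 :* k :^ 2))) refl k)
             (frac≤c₁*frac⇒ {disagreements σ D} {ℕ.pred (n * n)} {ℕ.pred (16 * k ^ 3)} few-disagreements)
    where open +-*-Solver
  sample-nonempty : 0 ℕ.< ∣S∣
  sample-nonempty = ∣S∣>0 u high (λ ∣S∣≡0 → ∣0-frac∣≤frac⇒ {agreeS u (D u)} {agree u (D u)} {N′} {ℕ.pred W}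
    (subst (λ s → ℚ.∣ frac (agreeS u (D u)) s - frac (agree u (D u)) N ∣ ≤ℚ frac 1 W) ∣S∣≡0 (good′ u (D u))))
  near : ∀ x a → Near W (agreeS x a) ∣S∣ (agree x a) N
  near x a = ∣frac-frac∣≤frac⇒Near {agreeS x a} {∣S∣} {agree x a} {N′} {ℕ.pred W} sample-nonempty (good′ x a)
  j-max-counts : ∀ x → S x ≡ false → ∀ a → agreeS x a ≤ agreeS x (j x)
  j-max-counts x Sx a = frac-≤-numerator sample-nonempty (j-max x Sx a)
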